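{- Let $n, r \geq 2$ be integers. Then there exists an odd prime $p$ with $p \mid \binom{r+n}{n}$. In particular, $2^{r+n} \big/ \binom{r+n}{n} \notin \mathbb{Z}$. -}

-- Write C = (r + n) C n. Legendre's recursion ν₂((2a + e)!) = a + ν₂(a!) shows that ν₂(C) is
-- the number D of carries in the binary addition r + n (Kummer), and D carries force
-- 2^D ≤ r + n. On the other hand C ≥ 1 + r n > r + n once n, r ≥ 2, so C is not a power of 2
-- and any prime factor of its odd part is an odd prime dividing C.

module Submission where

open import Data.Bool.Base using (Bool; true; false)
open import Data.List.Base using ([]; _∷_)
open import Data.List.Relation.Unary.All using (_∷_)
open import Data.Nat.Base
open import Data.Nat.Combinatorics using (_C_; nCk≡n!/k![n-k]!; k![n∸k]!∣n!; nCk+nC[k+1]≡[n+1]C[k+1]; nCn≡1)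
open import Data.Nat.DivMod using (m/n*n≡m)
open import Data.Nat.Divisibility
open import Data.Nat.Induction using (<-wellFounded)
open import Data.Nat.Primality using (Prime; prime[2]; prime⇒nonTrivial; irreducible[2]; euclidsLemma)
open import Data.Nat.Primality.Factorisation using (factorise)
open import Data.Nat.Properties
open import Algebra.Properties.CommutativeSemigroup *-commutativeSemigroup using (interchange)
open import Data.Nat.Tactic.RingSolver using (solve-∀)
open import Data.Product.Base using (∃-syntax; ∃₂; _×_; _,_; proj₁; proj₂; map)
open import Data.Sum.Base using (inj₁; inj₂; [_,_]′)
open import Function.Base using (_∘_)
open import Induction.WellFounded using (Acc; acc)
open import Relation.Binary.PropositionalEquality
open import Relation.Nullary using (¬_; contradiction)

bit : Bool → ℕ
bit false = 0
bit true  = 1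

halve : ∀ m → ∃₂ λ e q → m ≡ bit e + 2 * q
halve zero = false , 0 , refl
halve (suc m) with halve m
... | false , q , refl = true , q , refl
... | true  , q , refl = false , suc q , cong suc (sym (+-suc q (q + 0)))

fullAdder : ∀ x y z → ∃₂ λ u t → bit x + bit y + bit z ≡ bit u + 2 * bit t
fullAdder false false false = false , false , refl
fullAdder false false true  = true  , false , refl
fullAdder false true  false = true  , false , refl
fullAdder false true  true  = false , true  , refl
fullAdder true  false false = true  , false , refl
fullAdder true  false true  = false , true  , refl
fullAdder true  true  false = false , true  , refl
fullAdder true  true  true  = true  , true  , refl

x≡m+2*q⇒q<x : ∀ {x} m q → x ≡ m + 2 * q → .{{NonZero x}} → q < x
x≡m+2*q⇒q<x {x} m zero    _    = >-nonZero⁻¹ x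
x≡m+2*q⇒q<x m (suc q) refl = ≤-trans (subst (suc q <_) (*-comm (suc q) 2) (m<m*n (suc q) 2 ≤-refl)) (m≤n+m _ m)

2∤1+2* : ∀ q → 2 ∤ suc (2 * q)
2∤1+2* q (divides d eq) = even≢odd d q (sym (trans eq (*-comm d 2)))

2∤* : ∀ {m n} → 2 ∤ m → 2 ∤ n → 2 ∤ m * n
2∤* {m} {n} 2∤m 2∤n = [ 2∤m , 2∤n ]′ ∘ euclidsLemma m n prime[2]

infix 4 2^_∥_

record 2^_∥_ (k x : ℕ) : Set where
  constructor odd-part
  field
    o       : ℕ
    2∤o     : 2 ∤ o
    x≡2^k*o : x ≡ 2 ^ k * o

∥-odd : ∀ {o} → 2 ∤ o → 2^ 0 ∥ o
∥-odd {o} 2∤o = odd-part o 2∤o (sym (*-identityˡ o))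

∥-2^ : ∀ k → 2^ k ∥ 2 ^ k
∥-2^ k = odd-part 1 (2∤1+2* 0) (sym (*-identityʳ (2 ^ k)))

∥-* : ∀ {k l x y} → 2^ k ∥ x → 2^ l ∥ y → 2^ (k + l) ∥ x * y
∥-* {k} {l} (odd-part o 2∤o refl) (odd-part o′ 2∤o′ refl) = odd-part (o * o′) (2∤* 2∤o 2∤o′) (begin
  2 ^ k * o * (2 ^ l * o′)  ≡⟨ interchange (2 ^ k) o (2 ^ l) o′ ⟩
  2 ^ k * 2 ^ l * (o * o′)  ≡⟨ cong (_* (o * o′)) (^-distribˡ-+-* 2 k l) ⟨
  2 ^ (k + l) * (o * o′)    ∎)
  where open ≡-Reasoning

∥-double : ∀ {k x} → 2^ k ∥ x → 2^ suc k ∥ 2 * x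
∥-double {k} (odd-part o 2∤o refl) = odd-part o 2∤o (sym (*-assoc 2 (2 ^ k) o))

∥⇒2∣ : ∀ {k x} → 2^ suc k ∥ x → 2 ∣ x
∥⇒2∣ {k} (odd-part o _ refl) = ∣-trans (m∣m*n (2 ^ k)) (m∣m*n o)

∥-unique : ∀ {k l x} → 2^ k ∥ x → 2^ l ∥ x → k ≡ l
∥-unique {zero}  {zero}  _ _ = refl
∥-unique {zero}  {suc l} (odd-part o 2∤o refl) h = contradiction (subst (2 ∣_) (*-identityˡ o) (∥⇒2∣ h)) 2∤o
∥-unique {suc k} {zero}  h (odd-part o 2∤o refl) = contradiction (subst (2 ∣_) (*-identityˡ o) (∥⇒2∣ h)) 2∤o
∥-unique {suc k} {suc l} (odd-part o 2∤o refl) (odd-part o′ 2∤o′ eq) =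
  cong suc (∥-unique (odd-part o 2∤o refl) (odd-part o′ 2∤o′ (*-cancelˡ-≡ _ _ 2 halves≡)))
  where
  halves≡ : 2 * (2 ^ k * o) ≡ 2 * (2 ^ l * o′)
  halves≡ = trans (sym (*-assoc 2 (2 ^ k) o)) (trans eq (*-assoc 2 (2 ^ l) o′))

∥-exists : ∀ x → .{{NonZero x}} → ∃[ k ] 2^ k ∥ x
∥-exists x = go x (<-wellFounded x)
  where
  go : ∀ x → Acc _<_ x → .{{NonZero x}} → ∃[ k ] 2^ k ∥ x
  go x (acc rec) with halve x
  ... | true  , q , refl = 0 , ∥-odd (2∤1+2* q)
  ... | false , q , refl = map suc ∥-double (go q (rec (x≡m+2*q⇒q<x 0 q refl)) {{m*n≢0⇒n≢0 2}})

ν₂! : ℕ → ℕ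
ν₂! m = proj₁ (∥-exists (m !) {{m !≢0}})

2^ν₂!∥! : ∀ m → 2^ ν₂! m ∥ m !
2^ν₂!∥! m = proj₂ (∥-exists (m !) {{m !≢0}})

ν₂!-unique : ∀ m {k} → 2^ k ∥ m ! → ν₂! m ≡ k
ν₂!-unique m = ∥-unique (2^ν₂!∥! m)

oddFactorial : ℕ → ℕ
oddFactorial zero    = 1
oddFactorial (suc a) = suc (2 * a) * oddFactorial a

2∤oddFactorial : ∀ a → 2 ∤ oddFactorial a
2∤oddFactorial zero    = 2∤1+2* 0
2∤oddFactorial (suc a) = 2∤* (2∤1+2* a) (2∤oddFactorial a)

[2a]!≡2^a*oddFactorial*a! : ∀ a → (2 * a) ! ≡ 2 ^ a * (oddFactorial a * a !)
[2a]!≡2^a*oddFactorial*a! zero    = refl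
[2a]!≡2^a*oddFactorial*a! (suc a) = begin
  (2 * suc a) !
    ≡⟨ cong _! (*-suc 2 a) ⟩
  (2 + 2 * a) * ((1 + 2 * a) * (2 * a) !)
    ≡⟨ cong (λ f → (2 + 2 * a) * ((1 + 2 * a) * f)) ([2a]!≡2^a*oddFactorial*a! a) ⟩
  (2 + 2 * a) * ((1 + 2 * a) * (2 ^ a * (oddFactorial a * a !)))
    ≡⟨ regroup a (2 ^ a) (oddFactorial a) (a !) ⟩
  2 * 2 ^ a * ((1 + 2 * a) * oddFactorial a * ((1 + a) * a !))
    ∎
  where
  open ≡-Reasoning
  regroup : ∀ a P O F → (2 + 2 * a) * ((1 + 2 * a) * (P * (O * F))) ≡ 2 * P * ((1 + 2 * a) * O * ((1 + a) * F))
  regroup = solve-∀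

ν₂![b+2a]≡a+ν₂!a : ∀ e a → ν₂! (bit e + 2 * a) ≡ a + ν₂! a
ν₂![b+2a]≡a+ν₂!a e a = ν₂!-unique (bit e + 2 * a) (from e)
  where
  [2a]! : 2^ (a + ν₂! a) ∥ (2 * a) !
  [2a]! = subst (2^ (a + ν₂! a) ∥_) (sym ([2a]!≡2^a*oddFactorial*a! a))
                (∥-* (∥-2^ a) (∥-* (∥-odd (2∤oddFactorial a)) (2^ν₂!∥! a)))
  from : ∀ e → 2^ (a + ν₂! a) ∥ (bit e + 2 * a) !
  from false = [2a]!
  from true  = ∥-* (∥-odd (2∤1+2* a)) [2a]!

ν₂!0≡0 : ν₂! 0 ≡ 0
ν₂!0≡0 = ν₂!-unique 0 (∥-odd (2∤1+2* 0))

-- D is the number of carries in the binary addition c + a + b; the ⊔ 1 only matters for the sum 0.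
CarryBound : Bool → ℕ → ℕ → Set
CarryBound c a b = ∃[ D ] ν₂! (bit c + a + b) ≡ ν₂! a + ν₂! b + D × 2 ^ D ≤ (bit c + a + b) ⊔ 1

carry-bound-step : ∀ t u a b {D} → 2 ^ D ≤ (bit t + a + b) ⊔ 1 →
                   2 ^ (bit t + D) ≤ (bit u + 2 * (bit t + a + b)) ⊔ 1
carry-bound-step false u a b 2^D≤ =
  ≤-trans 2^D≤ (⊔-monoˡ-≤ 1 (≤-trans (m≤m+n (a + b) (a + b + 0)) (m≤n+m _ (bit u))))
carry-bound-step true u a b {D} 2^D≤ = begin
  2 * 2 ^ D                ≤⟨ *-monoʳ-≤ 2 (subst (2 ^ D ≤_) (m≥n⇒m⊔n≡m (s≤s z≤n)) 2^D≤) ⟩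
  2 * suc (a + b)          ≤⟨ m≤n+m _ (bit u) ⟩
  bit u + 2 * suc (a + b)  ≤⟨ m≤m⊔n _ 1 ⟩
  (bit u + 2 * suc (a + b)) ⊔ 1 ∎
  where open ≤-Reasoning

carry-zero : ∀ c → CarryBound c 0 0
carry-zero false = 0 , trans ν₂!0≡0 (cong (λ v → v + v + 0) (sym ν₂!0≡0)) , ≤-refl
carry-zero true  = 0 , trans ν₂!0≡0 (cong (λ v → v + v + 0) (sym ν₂!0≡0)) , ≤-refl

digitwise-+ : ∀ c x y a b → c + (x + 2 * a) + (y + 2 * b) ≡ c + x + y + 2 * (a + b)
digitwise-+ = solve-∀

add-with-carry : ∀ c x y u t a b → c + x + y ≡ u + 2 * t →
                 c + (x + 2 * a) + (y + 2 * b) ≡ u + 2 * (t + a + b)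
add-with-carry c x y u t a b adder = begin
  c + (x + 2 * a) + (y + 2 * b)   ≡⟨ digitwise-+ c x y a b ⟩
  c + x + y + 2 * (a + b)         ≡⟨ cong (_+ 2 * (a + b)) adder ⟩
  u + 2 * t + 2 * (a + b)         ≡⟨ carry-in u t a b ⟩
  u + 2 * (t + a + b)             ∎
  where
  open ≡-Reasoning
  carry-in : ∀ u t a b → u + 2 * t + 2 * (a + b) ≡ u + 2 * (t + a + b)
  carry-in = solve-∀

ν₂!-carry-step : ∀ {c} ε δ u t a b D → bit c + bit ε + bit δ ≡ bit u + 2 * bit t →
                 ν₂! (bit t + a + b) ≡ ν₂! a + ν₂! b + D →
                 ν₂! (bit c + (bit ε + 2 * a) + (bit δ + 2 * b)) ≡
                 ν₂! (bit ε + 2 * a) + ν₂! (bit δ + 2 * b) + (bit t + D)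
ν₂!-carry-step {c} ε δ u t a b D adder ν₂!S≡ = begin
  ν₂! (bit c + (bit ε + 2 * a) + (bit δ + 2 * b))
    ≡⟨ cong ν₂! (add-with-carry (bit c) (bit ε) (bit δ) (bit u) (bit t) a b adder) ⟩
  ν₂! (bit u + 2 * S)
    ≡⟨ ν₂![b+2a]≡a+ν₂!a u S ⟩
  S + ν₂! S
    ≡⟨ cong (S +_) ν₂!S≡ ⟩
  S + (ν₂! a + ν₂! b + D)
    ≡⟨ shuffle (bit t) a b (ν₂! a) (ν₂! b) D ⟩
  (a + ν₂! a) + (b + ν₂! b) + (bit t + D)
    ≡⟨ cong₂ (λ x y → x + y + (bit t + D)) (ν₂![b+2a]≡a+ν₂!a ε a) (ν₂![b+2a]≡a+ν₂!a δ b) ⟨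
  ν₂! (bit ε + 2 * a) + ν₂! (bit δ + 2 * b) + (bit t + D)
    ∎
  where
  open ≡-Reasoning
  S = bit t + a + b
  shuffle : ∀ t a b A B D → t + a + b + (A + B + D) ≡ a + A + (b + B) + (t + D)
  shuffle = solve-∀

carry-step : ∀ c a b → .{{NonZero (a + b)}} →
             (∀ c′ a′ b′ → a′ + b′ < a + b → CarryBound c′ a′ b′) → CarryBound c a b
carry-step c a b ih with halve a | halve b
... | ε , a′ , refl | δ , b′ , refl with fullAdder c ε δ
... | u , t , adder
  with ih t a′ b′ (x≡m+2*q⇒q<x (bit ε + bit δ) (a′ + b′) (digitwise-+ 0 (bit ε) (bit δ) a′ b′))
... | D , ν₂!≡ , 2^D≤ =
  bit t + D ,
  ν₂!-carry-step ε δ u t a′ b′ D adder ν₂!≡ ,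
  subst (λ s → 2 ^ (bit t + D) ≤ s ⊔ 1) (sym (add-with-carry (bit c) (bit ε) (bit δ) (bit u) (bit t) a′ b′ adder))
        (carry-bound-step t u a′ b′ 2^D≤)

carries : ∀ c a b → CarryBound c a b
carries c a b = go c a b (<-wellFounded (a + b))
  where
  go : ∀ c a b → Acc _<_ (a + b) → CarryBound c a b
  go c zero        zero        _         = carry-zero c
  go c a@(suc _)   b           (acc rec) = carry-step c a b λ c′ a′ b′ lt → go c′ a′ b′ (rec lt)
  go c zero        b@(suc _)   (acc rec) = carry-step c zero b λ c′ a′ b′ lt → go c′ a′ b′ (rec lt)

m!*n!*[m+n]Cn≡[m+n]! : ∀ m n → m ! * n ! * ((m + n) C n) ≡ (m + n) !
m!*n!*[m+n]Cn≡[m+n]! m n = begin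
  m ! * n ! * ((m + n) C n)
    ≡⟨ *-comm (m ! * n !) _ ⟩
  ((m + n) C n) * (m ! * n !)
    ≡⟨ cong (λ k → ((m + n) C n) * (k ! * n !)) (m+n∸n≡m m n) ⟨
  ((m + n) C n) * ((m + n ∸ n) ! * n !)
    ≡⟨ cong₂ _*_ (nCk≡n!/k![n-k]! n≤m+n) (*-comm _ (n !)) ⟩
  ((m + n) ! / (n ! * (m + n ∸ n) !)) * (n ! * (m + n ∸ n) !)
    ≡⟨ m/n*n≡m (k![n∸k]!∣n! n≤m+n) ⟩
  (m + n) !
    ∎
  where
  open ≡-Reasoning
  n≤m+n = m≤n+m n m
  instance _ = n !* (m + n ∸ n) !≢0

∥[m+n]Cn⇒2^e≤m+n⊔1 : ∀ m n {e} → 2^ e ∥ (m + n) C n → 2 ^ e ≤ (m + n) ⊔ 1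
∥[m+n]Cn⇒2^e≤m+n⊔1 m n {e} 2^e∥C with carries false m n
... | D , ν₂![m+n]≡ , 2^D≤ = subst (λ k → 2 ^ k ≤ (m + n) ⊔ 1) (sym e≡D) 2^D≤
  where
  ∥[m+n]! : 2^ (ν₂! m + ν₂! n + e) ∥ (m + n) !
  ∥[m+n]! = subst (2^ (ν₂! m + ν₂! n + e) ∥_) (m!*n!*[m+n]Cn≡[m+n]! m n)
                  (∥-* (∥-* (2^ν₂!∥! m) (2^ν₂!∥! n)) 2^e∥C)
  e≡D : e ≡ D
  e≡D = +-cancelˡ-≡ (ν₂! m + ν₂! n) e D (trans (sym (ν₂!-unique (m + n) ∥[m+n]!)) ν₂![m+n]≡)

1+m*n≤[m+n]Cn : ∀ m n → 1 + m * n ≤ (m + n) C n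
1+m*n≤[m+n]Cn m       zero    = ≤-reflexive (cong suc (*-zeroʳ m))
1+m*n≤[m+n]Cn zero    (suc n) = ≤-reflexive (sym (nCn≡1 (suc n)))
1+m*n≤[m+n]Cn (suc m) (suc n) = begin
  1 + suc m * suc n                           ≤⟨ m≤m+n _ (m * n) ⟩
  1 + suc m * suc n + m * n                   ≡⟨ arith m n ⟩
  (1 + suc m * n) + (1 + m * suc n)           ≤⟨ +-mono-≤ (1+m*n≤[m+n]Cn (suc m) n) (1+m*n≤[m+n]Cn m (suc n)) ⟩
  (suc m + n) C n + (m + suc n) C suc n       ≡⟨ cong (λ k → k C n + (m + suc n) C suc n) (+-suc m n) ⟨
  (m + suc n) C n + (m + suc n) C suc n       ≡⟨ nCk+nC[k+1]≡[n+1]C[k+1] (m + suc n) n ⟩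
  suc (m + suc n) C suc n                     ∎
  where
  open ≤-Reasoning
  arith : ∀ m n → 1 + suc m * suc n + m * n ≡ (1 + suc m * n) + (1 + m * suc n)
  arith = solve-∀

m+n≤m*n : ∀ {m n} → 2 ≤ m → 2 ≤ n → m + n ≤ m * n
m+n≤m*n {2+ a} {2+ b} (s≤s (s≤s _)) (s≤s (s≤s _)) = begin
  2+ a + 2+ b                        ≤⟨ m≤m+n _ (a + b + a * b) ⟩
  2+ a + 2+ b + (a + b + a * b)      ≡⟨ expand a b ⟩
  2+ a * 2+ b                        ∎
  where
  open ≤-Reasoning
  expand : ∀ a b → 2 + a + (2 + b) + (a + b + a * b) ≡ (2 + a) * (2 + b)
  expand = solve-∀

[m+n]Cn≢2^ : ∀ {m n} → 2 ≤ m → 2 ≤ n → ∀ k → (m + n) C n ≢ 2 ^ k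
[m+n]Cn≢2^ {m} {n} 2≤m 2≤n k C≡2^k = <⇒≱ m+n<2^k 2^k≤m+n
  where
  m+n<2^k : m + n < 2 ^ k
  m+n<2^k = begin-strict
    m + n            ≤⟨ m+n≤m*n 2≤m 2≤n ⟩
    m * n            <⟨ 1+m*n≤[m+n]Cn m n ⟩
    (m + n) C n      ≡⟨ C≡2^k ⟩
    2 ^ k            ∎
    where open ≤-Reasoning
  2^k≤m+n : 2 ^ k ≤ m + n
  2^k≤m+n = subst (2 ^ k ≤_) (m≥n⇒m⊔n≡m (≤-trans (s≤s z≤n) (≤-trans 2≤m (m≤m+n m n))))
                  (∥[m+n]Cn⇒2^e≤m+n⊔1 m n (subst (2^ k ∥_) (sym C≡2^k) (∥-2^ k)))

∃-prime-divisor : ∀ {x} → 1 < x → ∃[ p ] Prime p × p ∣ x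
∃-prime-divisor {x} 1<x with factorise x {{>-nonZero (<-trans z<s 1<x)}}
... | record { factors = [] ; isFactorisation = x≡1 } = contradiction x≡1 (>⇒≢ 1<x)
... | record { factors = p ∷ _ ; isFactorisation = x≡p*_ ; factorsPrime = p-prime ∷ _ } =
  p , p-prime , subst (p ∣_) (sym x≡p*_) (m∣m*n _)

∃-odd-prime-divisor : ∀ x → .{{NonZero x}} → (∀ k → x ≢ 2 ^ k) → ∃[ p ] Prime p × p ≢ 2 × p ∣ x
∃-odd-prime-divisor x x≢2^ with ∥-exists x
... | k , odd-part o 2∤o x≡2^k*o =
  let p , p-prime , p∣o = ∃-prime-divisor 1<o in
  p , p-prime , (λ p≡2 → 2∤o (subst (_∣ o) p≡2 p∣o)) ,
  subst (p ∣_) (sym x≡2^k*o) (∣-trans p∣o (n∣m*n (2 ^ k)))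
  where
  o≢0 : o ≢ 0
  o≢0 refl = 2∤o (2 ∣0)
  o≢1 : o ≢ 1
  o≢1 refl = x≢2^ k (trans x≡2^k*o (*-identityʳ (2 ^ k)))
  1<o : 1 < o
  1<o = ≤∧≢⇒< (n≢0⇒n>0 o≢0) (o≢1 ∘ sym)

prime∣2^⇒≡2 : ∀ {p} k → Prime p → p ∣ 2 ^ k → p ≡ 2
prime∣2^⇒≡2 {p} zero    p-prime p∣1 = contradiction (∣1⇒≡1 p∣1) (nonTrivial⇒≢1 {{prime⇒nonTrivial p-prime}})
prime∣2^⇒≡2 {p} (suc k) p-prime p∣2^[1+k] with euclidsLemma 2 (2 ^ k) p-prime p∣2^[1+k]
... | inj₂ p∣2^k = prime∣2^⇒≡2 k p-prime p∣2^k
... | inj₁ p∣2 with irreducible[2] p∣2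
...   | inj₁ p≡1 = contradiction p≡1 (nonTrivial⇒≢1 {{prime⇒nonTrivial p-prime}})
...   | inj₂ p≡2 = p≡2

lemma4p8 : (n r : ℕ) → 2 ≤ n → 2 ≤ r →
    (∃[ p ] (Prime p × p ≢ 2 × p ∣ ((r + n) C n))) × ¬ (((r + n) C n) ∣ (2 ^ (r + n)))
lemma4p8 n r 2≤n 2≤r
  with ∃-odd-prime-divisor ((r + n) C n) {{>-nonZero (<-≤-trans z<s (1+m*n≤[m+n]Cn r n))}} ([m+n]Cn≢2^ 2≤r 2≤n)
... | p , p-prime , p≢2 , p∣C =
  (p , p-prime , p≢2 , p∣C) , λ C∣2^ → p≢2 (prime∣2^⇒≡2 (r + n) p-prime (∣-trans p∣C C∣2^))
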